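{- Let $G$ be a graph and $M$ a perfect matching of $G$. Then $M$ is the only fractional perfect matching of $G$ if and only if the local digraph $\mathrm{ldg}(G,M)$ is acyclic.
   Context: Graphs are finite and simple. A fractional perfect matching of $G$ is $w:E(G)\to[0,1]$ with $\sum_{u:uv\in E(G)}w(uv)=1$ for every vertex $v$ (a perfect matching is identified with its indicator function). A locally directed graph is a finite multigraph without loops with a sign $\mathrm{sgn}(v,e)\in\{+,-\}$ for each incident vertex–edge pair; two are isomorphic if there are bijections on vertices and edges forming a multigraph isomorphism such that for any two edges $e,e'$ sharing a vertex $v$, $\mathrm{sgn}(v,e)=\mathrm{sgn}(v,e')$ iff the corresponding signs of the images agree. $\mathrm{ldg}(G,M)$ is defined (up to isomorphism) as follows: its vertices are $v_e$ for $e\in M$; for each $e\in M$ fix a bijection $\mathrm{sgn}_e$ from the endpoints of $e$ to $\{+,-\}$; for each edge $f\in E(G)\setminus M$, with $e_1,e_2\in M$ the matching edges containing its two endpoints, add an edge $\tilde f$ between $v_{e_1}$ and $v_{e_2}$ with $\mathrm{sgn}(v_{e_i},\tilde f)=\mathrm{sgn}_{e_i}(e_i\cap f)$ for $i=1,2$. A locally directed closed walk is a sequence $v_1,e_1,v_2,\dots,v_t,e_t,v_{t+1}=v_1$ where $e_i$ is an edge between $v_i$ and $v_{i+1}$ and, with $e_0=e_t$, $\mathrm{sgn}(v_i,e_i)\ne\mathrm{sgn}(v_i,e_{i-1})$ for all $i$; the local digraph is acyclic if it has no such walk.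
   Formalization: The fractional perfect matchings of G take rational values in [0,1] rather than real ones. -}

module Defs where

open import Data.Nat using (ℕ)
open import Data.Fin using (Fin; zero; suc; _<_)
open import Data.Fin.Properties using (<-cmp)
open import Data.Bool using (Bool; true; false; if_then_else_)
open import Data.Product using (Σ; _×_; _,_; proj₁; proj₂)
open import Data.List using (List; []; _∷_; _++_; [_])
open import Data.List.Relation.Unary.Linked using (Linked)
open import Data.Rational using (ℚ; 0ℚ; 1ℚ; _+_; _≤_)
open import Relation.Binary.PropositionalEquality using (_≡_; refl; sym; trans; subst)
open import Relation.Binary.Definitions using (tri<; tri≈; tri>)
open import Relation.Nullary using (¬_)
open import Data.Empty using (⊥-elim)
open import Function.Bundles using (_⇔_)

record Graph (n : ℕ) : Set where
  field
    Adj     : Fin n → Fin n → Bool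
    symm    : ∀ u v → Adj u v ≡ Adj v u
    irrefl  : ∀ v → Adj v v ≡ false
open Graph public

record IsPerfectMatching {n : ℕ} (G : Graph n) (M : Fin n → Fin n → Bool) : Set where
  field
    sub     : ∀ u v → M u v ≡ true → Adj G u v ≡ true
    msymm   : ∀ u v → M u v ≡ M v u
    partner : Fin n → Fin n
    matched : ∀ v → M v (partner v) ≡ true
    unique  : ∀ v w → M v w ≡ true → w ≡ partner v
open IsPerfectMatching public

-- Fractional perfect matchings (weights in ℚ).
-- A function E(G) → [0,1] is encoded as a symmetric w : Fin n → Fin n → ℚ
-- vanishing on non-edges.

∑ : ∀ {n} → (Fin n → ℚ) → ℚ
∑ {ℕ.zero}  f = 0ℚ
∑ {ℕ.suc n} f = f zero + ∑ (λ i → f (suc i))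

record IsFPM {n : ℕ} (G : Graph n) (w : Fin n → Fin n → ℚ) : Set where
  field
    wsymm   : ∀ u v → w u v ≡ w v u
    offEdge : ∀ u v → Adj G u v ≡ false → w u v ≡ 0ℚ
    lower   : ∀ u v → 0ℚ ≤ w u v
    upper   : ∀ u v → w u v ≤ 1ℚ
    sumOne  : ∀ v → ∑ (λ u → w v u) ≡ 1ℚ

indicator : ∀ {n} → (Fin n → Fin n → Bool) → Fin n → Fin n → ℚ
indicator M u v = if M u v then 1ℚ else 0ℚ

OnlyFPM : ∀ {n} → Graph n → (Fin n → Fin n → Bool) → Set
OnlyFPM G M = IsFPM G (indicator M)
            × (∀ w → IsFPM G w → ∀ u v → w u v ≡ indicator M u v)

-- Locally directed graphs (multigraphs with a sign at each vertex–edge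
-- incidence).  Each edge e has two ends src e, tgt e with signs.

data Sign : Set where
  plus minus : Sign

record LDG : Set₁ where
  field
    V      : Set
    E      : Set
    src    : E → V
    tgt    : E → V
    sgnSrc : E → Sign
    sgnTgt : E → Sign

module _ (L : LDG) where
  open LDG L

  -- a traversal of an edge: false = src→tgt, true = tgt→src
  Dart : Set
  Dart = E × Bool

  tailD headD : Dart → V
  tailD (e , false) = src e
  tailD (e , true)  = tgt e
  headD (e , false) = tgt e
  headD (e , true)  = src e

  tailSgn headSgn : Dart → Sign
  tailSgn (e , false) = sgnSrc e
  tailSgn (e , true)  = sgnTgt e
  headSgn (e , false) = sgnTgt e
  headSgn (e , true)  = sgnSrc e

  Step : Dart → Dart → Set
  Step d d' = headD d ≡ tailD d' × ¬ (headSgn d ≡ tailSgn d')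

  -- closed walk d₁ … d_t (t ≥ 1); the wrap-around condition between d_t and
  -- d₁ is imposed by appending d₁ again.
  record LDClosedWalk : Set where
    field
      first : Dart
      rest  : List Dart
      steps : Linked Step (first ∷ rest ++ [ first ])

  Acyclic : Set
  Acyclic = ¬ LDClosedWalk

module _ {n : ℕ} (G : Graph n) (M : Fin n → Fin n → Bool)
         (pm : IsPerfectMatching G M) where

  MEdge : Set
  MEdge = Σ (Fin n × Fin n) λ p → proj₁ p < proj₂ p × M (proj₁ p) (proj₂ p) ≡ true

  NonMEdge : Set
  NonMEdge = Σ (Fin n × Fin n) λ p →
    proj₁ p < proj₂ p × Adj G (proj₁ p) (proj₂ p) ≡ true × M (proj₁ p) (proj₂ p) ≡ false

  private
    noSelf : ∀ v → ¬ (v ≡ partner pm v)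
    noSelf v eq with trans (sym (irrefl G v))
                     (subst (λ x → Adj G v x ≡ true) (sym eq) (sub pm v (partner pm v) (matched pm v)))
    ... | ()

  medge : Fin n → MEdge
  medge v with <-cmp v (partner pm v)
  ... | tri< lt _ _ = (v , partner pm v) , lt , matched pm v
  ... | tri≈ _ eq _ = ⊥-elim (noSelf v eq)
  ... | tri> _ _ gt = (partner pm v , v) , gt ,
                      trans (msymm pm (partner pm v) v) (matched pm v)

  -- sgn_e : endpoints of e → {+,-}; the smaller endpoint gets +
  msign : Fin n → Sign
  msign v with <-cmp v (partner pm v)
  ... | tri< _ _ _ = plus
  ... | tri≈ _ _ _ = plus
  ... | tri> _ _ _ = minus

  ldg : LDG
  ldg = record
    { V      = MEdge
    ; E      = NonMEdge
    ; src    = λ f → medge (proj₁ (proj₁ f))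
    ; tgt    = λ f → medge (proj₂ (proj₁ f))
    ; sgnSrc = λ f → msign (proj₁ (proj₁ f))
    ; sgnTgt = λ f → msign (proj₂ (proj₁ f))
    }

{-# OPTIONS --safe #-}

-- Steps of a locally directed walk in ldg(G, M) are exactly "leave a vertex along an edge
-- of G ∖ M, then cross the matching edge at its end", so closed walks are closed
-- M-alternating walks.
--
-- Such a walk d₁ … d_t moves M: add weight 1/2t to each of its unmatched edges and remove
-- 1/2t from each matching edge it crosses. Every vertex is entered and left equally often,
-- so row sums stay 1, giving a second fractional perfect matching.
--
-- Conversely, let w ≠ M be a fractional perfect matching. Then some x is unsaturated,
-- w(x, mate x) < 1, so x has an unmatched edge xu of positive weight; u is then unsaturated
-- as well, and we continue from mate u. By pigeonhole this alternating walk closes up.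

module Submission where

open import Defs
open import Algebra.Bundles using (Ring)
import Algebra.Properties.Group as GroupProperties
import Algebra.Properties.Semiring.Sum as SemiringSum
open import Axiom.UniquenessOfIdentityProofs using (module Decidable⇒UIP)
open import Data.Bool using (Bool; true; false; not; if_then_else_)
import Data.Bool.Properties as Boolₚ
open import Data.Empty using (⊥-elim)
open import Data.Fin as Fin using (Fin; zero; suc; punchIn; punchOut; toℕ)
import Data.Fin.Properties as Finₚ
open import Data.List as List using (List; []; _∷_; _++_; [_])
open import Data.List.Relation.Unary.Linked using (Linked; [-]; _∷_)
open import Data.Nat as ℕ using (ℕ; zero; suc)
open import Data.Nat.GeneralisedArithmetic using (iterate)
import Data.Nat.Properties as ℕₚ
open import Data.Product using (Σ; ∃; _×_; _,_; proj₁; proj₂; uncurry)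
open import Data.Rational
  using (ℚ; 0ℚ; 1ℚ; _+_; _*_; -_; _-_; _≤_; _<_; 1/_; Positive; NonZero; positive; nonNegative)
open import Data.Rational.Properties
open import Data.Rational.Solver using (module +-*-Solver)
open import Data.Sum using (_⊎_; inj₁; inj₂; [_,_]′)
open import Function.Base using (_∘_; id)
open import Function.Bundles using (_⇔_; mk⇔; Equivalence)
open import Relation.Binary.Definitions using (tri<; tri≈; tri>)
open import Relation.Binary.PropositionalEquality hiding ([_])
open import Relation.Nullary using (¬_; does; yes; no)
open import Relation.Nullary.Decidable using (_⊎-dec_)

open +-*-Solver
module Sum = SemiringSum (Ring.semiring +-*-ring)
open GroupProperties +-0-group using (identityʳ-unique; ∙-cancelʳ)

private
  variable
    n : ℕ

∑≡sum : (f : Fin n → ℚ) → ∑ f ≡ Sum.sum f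
∑≡sum {zero}  f = refl
∑≡sum {suc n} f = cong (f zero +_) (∑≡sum (f ∘ suc))

∑-cong : {f g : Fin n → ℚ} → (∀ i → f i ≡ g i) → ∑ f ≡ ∑ g
∑-cong {f = f} {g} f≗g = trans (∑≡sum f) (trans (Sum.sum-cong-≗ f≗g) (sym (∑≡sum g)))

∑-distrib-+ : (f g : Fin n → ℚ) → ∑ (λ i → f i + g i) ≡ ∑ f + ∑ g
∑-distrib-+ f g = begin
  ∑ (λ i → f i + g i)      ≡⟨ ∑≡sum (λ i → f i + g i) ⟩
  Sum.sum (λ i → f i + g i) ≡⟨ Sum.∑-distrib-+ f g ⟩
  Sum.sum f + Sum.sum g     ≡⟨ cong₂ _+_ (∑≡sum f) (∑≡sum g) ⟨
  ∑ f + ∑ g                 ∎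
  where open ≡-Reasoning

*-distribˡ-∑ : ∀ c (f : Fin n → ℚ) → c * ∑ f ≡ ∑ (λ i → c * f i)
*-distribˡ-∑ c f = begin
  c * ∑ f                   ≡⟨ cong (c *_) (∑≡sum f) ⟩
  c * Sum.sum f             ≡⟨ Sum.*-distribˡ-sum c f ⟩
  Sum.sum (λ i → c * f i)   ≡⟨ ∑≡sum (λ i → c * f i) ⟨
  ∑ (λ i → c * f i)         ∎
  where open ≡-Reasoning

∑-zero : ∑ {n} (λ _ → 0ℚ) ≡ 0ℚ
∑-zero {n} = trans (∑≡sum {n} (λ _ → 0ℚ)) (Sum.sum-replicate-zero n)

∑-remove : (f : Fin (suc n) → ℚ) (i : Fin (suc n)) → ∑ f ≡ f i + ∑ (f ∘ punchIn i)
∑-remove f i = begin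
  ∑ f                        ≡⟨ ∑≡sum f ⟩
  Sum.sum f                  ≡⟨ Sum.sum-remove {i = i} f ⟩
  f i + Sum.sum (f ∘ punchIn i) ≡⟨ cong (f i +_) (∑≡sum (f ∘ punchIn i)) ⟨
  f i + ∑ (f ∘ punchIn i)    ∎
  where open ≡-Reasoning

∑-neg : (f : Fin n → ℚ) → ∑ (λ i → - f i) ≡ - ∑ f
∑-neg {zero}  f = refl
∑-neg {suc n} f = trans (cong (- f zero +_) (∑-neg (f ∘ suc))) (sym (neg-distrib-+ (f zero) _))

∑-distrib-- : (f g : Fin n → ℚ) → ∑ (λ i → f i - g i) ≡ ∑ f - ∑ g
∑-distrib-- f g = trans (∑-distrib-+ f (λ i → - g i)) (cong (∑ f +_) (∑-neg g))

∑-mono-≤ : {f g : Fin n → ℚ} → (∀ i → f i ≤ g i) → ∑ f ≤ ∑ g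
∑-mono-≤ {zero}  f≤g = ≤-refl
∑-mono-≤ {suc n} f≤g = +-mono-≤ (f≤g zero) (∑-mono-≤ (f≤g ∘ suc))

∑-nonneg : {f : Fin n → ℚ} → (∀ i → 0ℚ ≤ f i) → 0ℚ ≤ ∑ f
∑-nonneg {n} {f} f≥0 = subst (_≤ ∑ f) (∑-zero {n}) (∑-mono-≤ f≥0)

p≤p+q : ∀ p {q} → 0ℚ ≤ q → p ≤ p + q
p≤p+q p {q} q≥0 = subst (_≤ p + q) (+-identityʳ p) (+-monoʳ-≤ p q≥0)

p<p+q : ∀ p {q} → 0ℚ < q → p < p + q
p<p+q p {q} q>0 = subst (_< p + q) (+-identityʳ p) (+-monoʳ-< p q>0)

p+q≤p⇒q≤0 : ∀ p {q} → p + q ≤ p → q ≤ 0ℚ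
p+q≤p⇒q≤0 p {q} p+q≤p = subst₂ _≤_
  (solve 2 (λ p q → (p :+ q) :- p := q) refl p q) (+-inverseʳ p) (+-monoˡ-≤ (- p) p+q≤p)

0≤εx≤1 : ∀ {ε K x} → 0ℚ ≤ ε → ε * K ≡ 1ℚ → 0ℚ ≤ x → x ≤ K →
         0ℚ ≤ ε * x × ε * x ≤ 1ℚ
0≤εx≤1 {ε} {K} {x} 0≤ε εK≡1 0≤x x≤K =
  subst (_≤ ε * x) (*-zeroʳ ε) (*-monoˡ-≤-nonNeg ε 0≤x) ,
  subst (ε * x ≤_) εK≡1 (*-monoˡ-≤-nonNeg ε x≤K)
  where instance _ = nonNegative 0≤ε

∑-≥-single : (f : Fin n → ℚ) → (∀ i → 0ℚ ≤ f i) → ∀ i → f i ≤ ∑ f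
∑-≥-single {suc n} f f≥0 i =
  subst (f i ≤_) (sym (∑-remove f i)) (p≤p+q (f i) (∑-nonneg (f≥0 ∘ punchIn i)))

∑-≥-pair : (f : Fin n → ℚ) → (∀ i → 0ℚ ≤ f i) → ∀ {i j} → i ≢ j → f i + f j ≤ ∑ f
∑-≥-pair {suc n} f f≥0 {i} {j} i≢j = subst (f i + f j ≤_) (sym (∑-remove f i))
  (+-monoʳ-≤ (f i) (subst (_≤ ∑ (f ∘ punchIn i)) (cong f (Finₚ.punchIn-punchOut i≢j))
    (∑-≥-single (f ∘ punchIn i) (f≥0 ∘ punchIn i) (punchOut i≢j))))

∑-≤-support : (f : Fin n → ℚ) (i : Fin n) → (∀ j → j ≢ i → f j ≤ 0ℚ) → ∑ f ≤ f i
∑-≤-support {suc n} f i f≤0 = subst (_≤ f i) (sym (∑-remove f i))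
  (subst (f i + ∑ (f ∘ punchIn i) ≤_) (+-identityʳ (f i))
    (+-monoʳ-≤ (f i) (subst (∑ (f ∘ punchIn i) ≤_) (∑-zero {n})
      (∑-mono-≤ (λ j → f≤0 (punchIn i j) (Finₚ.punchInᵢ≢i i j))))))

δ : Fin n → Fin n → ℚ
δ i j = if does (i Finₚ.≟ j) then 1ℚ else 0ℚ

δ-refl : (i : Fin n) → δ i i ≡ 1ℚ
δ-refl i with i Finₚ.≟ i
... | yes _   = refl
... | no  i≢i = ⊥-elim (i≢i refl)

∑-δ : (j : Fin n) → ∑ (λ i → δ i j) ≡ 1ℚ
∑-δ {suc n} zero    = cong (1ℚ +_) (∑-zero {n})
∑-δ {suc n} (suc j) = cong (0ℚ +_) (∑-δ j)

δ*δ≡0 : (a b c d : Fin n) → ¬ (a ≡ b × c ≡ d) → δ a b * δ c d ≡ 0ℚ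
δ*δ≡0 a b c d ¬eqs with a Finₚ.≟ b
... | no  _   = *-zeroˡ (δ c d)
... | yes a≡b with c Finₚ.≟ d
...   | no  _   = *-zeroʳ 1ℚ
...   | yes c≡d = ⊥-elim (¬eqs (a≡b , c≡d))

0≤δ*δ≤1 : (a b c d : Fin n) → 0ℚ ≤ δ a b * δ c d × δ a b * δ c d ≤ 1ℚ
0≤δ*δ≤1 a b c d with a Finₚ.≟ b | c Finₚ.≟ d
... | yes _ | yes _ = ≤ᵇ⇒≤ _ , ≤ᵇ⇒≤ _
... | yes _ | no  _ = ≤ᵇ⇒≤ _ , ≤ᵇ⇒≤ _
... | no  _ | yes _ = ≤ᵇ⇒≤ _ , ≤ᵇ⇒≤ _
... | no  _ | no  _ = ≤ᵇ⇒≤ _ , ≤ᵇ⇒≤ _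

edge : Fin n → Fin n → Fin n → Fin n → ℚ
edge a b u v = δ u a * δ v b + δ u b * δ v a

edge-sym : (a b u v : Fin n) → edge a b u v ≡ edge a b v u
edge-sym a b u v = solve 4 (λ x y z t → x :* y :+ z :* t := t :* z :+ y :* x) refl
  (δ u a) (δ v b) (δ u b) (δ v a)

0≤edge≤2 : (a b u v : Fin n) → 0ℚ ≤ edge a b u v × edge a b u v ≤ 1ℚ + 1ℚ
0≤edge≤2 a b u v with 0≤δ*δ≤1 u a v b | 0≤δ*δ≤1 u b v a
... | 0≤x , x≤1 | 0≤y , y≤1 = +-mono-≤ 0≤x 0≤y , +-mono-≤ x≤1 y≤1

1≤edge-self : (a b : Fin n) → 1ℚ ≤ edge a b a b
1≤edge-self a b = subst (λ x → x ≤ edge a b a b) (cong₂ _*_ (δ-refl a) (δ-refl b))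
  (p≤p+q (δ a a * δ b b) (proj₁ (0≤δ*δ≤1 a b b a)))

edge-outside : (R : Fin n → Fin n → Bool) → (∀ x y → R x y ≡ R y x) →
               ∀ {a b u v} → R a b ≢ R u v → edge a b u v ≡ 0ℚ
edge-outside R R-sym {a} {b} {u} {v} R≢ = cong₂ _+_
  (δ*δ≡0 u a v b λ { (refl , refl) → R≢ refl })
  (δ*δ≡0 u b v a λ { (refl , refl) → R≢ (R-sym a b) })

∑-edge : (a b x : Fin n) → ∑ (edge a b x) ≡ δ x a + δ x b
∑-edge a b x = begin
  ∑ (edge a b x)
    ≡⟨ ∑-distrib-+ (λ v → δ x a * δ v b) (λ v → δ x b * δ v a) ⟩
  ∑ (λ v → δ x a * δ v b) + ∑ (λ v → δ x b * δ v a)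
    ≡⟨ cong₂ _+_ (*-distribˡ-∑ (δ x a) (λ v → δ v b)) (*-distribˡ-∑ (δ x b) (λ v → δ v a)) ⟨
  δ x a * ∑ (λ v → δ v b) + δ x b * ∑ (λ v → δ v a)
    ≡⟨ cong₂ _+_ (cong (δ x a *_) (∑-δ b)) (cong (δ x b *_) (∑-δ a)) ⟩
  δ x a * 1ℚ + δ x b * 1ℚ
    ≡⟨ cong₂ _+_ (*-identityʳ (δ x a)) (*-identityʳ (δ x b)) ⟩
  δ x a + δ x b
    ∎
  where open ≡-Reasoning

capacity : {A : Set} → List A → ℚ
capacity []       = 0ℚ
capacity (_ ∷ as) = (1ℚ + 1ℚ) + capacity as

0≤capacity : {A : Set} (as : List A) → 0ℚ ≤ capacity as
0≤capacity []       = ≤-refl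
0≤capacity (_ ∷ as) = +-mono-≤ {0ℚ} {1ℚ + 1ℚ} (≤ᵇ⇒≤ _) (0≤capacity as)

module _ {A : Set} (s t : A → Fin n) where

  edgeSum : List A → Fin n → Fin n → ℚ
  edgeSum []       u v = 0ℚ
  edgeSum (a ∷ as) u v = edge (s a) (t a) u v + edgeSum as u v

  degree : Fin n → List A → ℚ
  degree x []       = 0ℚ
  degree x (a ∷ as) = (δ x (s a) + δ x (t a)) + degree x as

  ∑-edgeSum : ∀ as x → ∑ (edgeSum as x) ≡ degree x as
  ∑-edgeSum []       x = ∑-zero {n}
  ∑-edgeSum (a ∷ as) x =
    trans (∑-distrib-+ (edge (s a) (t a) x) (edgeSum as x))
          (cong₂ _+_ (∑-edge (s a) (t a) x) (∑-edgeSum as x))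

  edgeSum-sym : ∀ as u v → edgeSum as u v ≡ edgeSum as v u
  edgeSum-sym []       u v = refl
  edgeSum-sym (a ∷ as) u v = cong₂ _+_ (edge-sym (s a) (t a) u v) (edgeSum-sym as u v)

  0≤edgeSum≤capacity : ∀ as u v → 0ℚ ≤ edgeSum as u v × edgeSum as u v ≤ capacity as
  0≤edgeSum≤capacity []       u v = ≤-refl , ≤-refl
  0≤edgeSum≤capacity (a ∷ as) u v with 0≤edge≤2 (s a) (t a) u v | 0≤edgeSum≤capacity as u v
  ... | 0≤e , e≤2 | 0≤es , es≤c = +-mono-≤ 0≤e 0≤es , +-mono-≤ e≤2 es≤c

  edgeSum-outside : (R : Fin n → Fin n → Bool) → (∀ x y → R x y ≡ R y x) →
                    ∀ {r u v} → (∀ a → R (s a) (t a) ≡ r) → R u v ≡ not r →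
                    ∀ as → edgeSum as u v ≡ 0ℚ
  edgeSum-outside R R-sym R-st Ruv []       = refl
  edgeSum-outside R R-sym R-st Ruv (a ∷ as) = cong₂ _+_
    (edge-outside R R-sym (λ eq → Boolₚ.not-¬ refl (trans (sym (R-st a)) (trans eq Ruv))))
    (edgeSum-outside R R-sym R-st Ruv as)

iterate-suc : {A : Set} (f : A → A) (x : A) (k : ℕ) → f (iterate f x k) ≡ iterate f (f x) k
iterate-suc f x zero    = refl
iterate-suc f x (suc k) = iterate-suc f (f x) k

iterate-+ : {A : Set} (f : A → A) (x : A) (j k : ℕ) → iterate f x (j ℕ.+ k) ≡ iterate f (iterate f x j) k
iterate-+ f x zero    k = refl
iterate-+ f x (suc j) k = iterate-+ f (f x) j k

module _ (G : Graph n) (M : Fin n → Fin n → Bool) (pm : IsPerfectMatching G M) where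

  mate : Fin n → Fin n
  mate = partner pm

  mate-involutive : ∀ v → mate (mate v) ≡ v
  mate-involutive v = sym (unique pm (mate v) v (trans (msymm pm (mate v) v) (matched pm v)))

  mate-adjacent : ∀ v → Adj G v (mate v) ≡ true
  mate-adjacent v = sub pm v (mate v) (matched pm v)

  mate-irreflexive : ∀ v → v ≢ mate v
  mate-irreflexive v v≡mate
    with () ← trans (sym (irrefl G v)) (subst (λ u → Adj G v u ≡ true) (sym v≡mate) (mate-adjacent v))

  M-unmatched : ∀ {u v} → v ≢ mate u → M u v ≡ false
  M-unmatched {u} {v} v≢mate with M u v in eq
  ... | true  = ⊥-elim (v≢mate (unique pm u v eq))
  ... | false = refl

  indicator-onMate : ∀ u → indicator M u (mate u) ≡ 1ℚ
  indicator-onMate u = cong (λ b → if b then 1ℚ else 0ℚ) (matched pm u)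

  indicator-offMate : ∀ {u v} → v ≢ mate u → indicator M u v ≡ 0ℚ
  indicator-offMate v≢mate = cong (λ b → if b then 1ℚ else 0ℚ) (M-unmatched v≢mate)

  indicator≡δ-mate : ∀ u v → indicator M u v ≡ δ v (mate u)
  indicator≡δ-mate u v with v Finₚ.≟ mate u
  ... | yes refl  = indicator-onMate u
  ... | no v≢mate = indicator-offMate v≢mate

  indicator-isFPM : IsFPM G (indicator M)
  indicator-isFPM = record
    { wsymm   = λ u v → cong (λ b → if b then 1ℚ else 0ℚ) (msymm pm u v)
    ; offEdge = offEdge
    ; lower   = λ u v → proj₁ (bounds u v)
    ; upper   = λ u v → proj₂ (bounds u v)
    ; sumOne  = λ u → trans (∑-cong (indicator≡δ-mate u)) (∑-δ (mate u))
    }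
    where
    offEdge : ∀ u v → Adj G u v ≡ false → indicator M u v ≡ 0ℚ
    offEdge u v ¬adj with M u v in eq
    ... | true  with () ← trans (sym (sub pm u v eq)) ¬adj
    ... | false = refl
    bounds : ∀ u v → 0ℚ ≤ indicator M u v × indicator M u v ≤ 1ℚ
    bounds u v with M u v
    ... | true  = ≤ᵇ⇒≤ _ , ≤-refl
    ... | false = ≤-refl , ≤ᵇ⇒≤ _

  MEdge-≡ : {e e′ : MEdge G M pm} → proj₁ e ≡ proj₁ e′ → e ≡ e′
  MEdge-≡ {(a , b) , a<b , m} {(.a , .b) , a<b′ , m′} refl
    rewrite Finₚ.<-irrelevant a<b a<b′ | Decidable⇒UIP.≡-irrelevant Boolₚ._≟_ m m′ = refl

  opposite-ends⇒mate : ∀ {u v} → medge G M pm u ≡ medge G M pm v → msign G M pm u ≢ msign G M pm v →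
                       v ≡ mate u
  opposite-ends⇒mate {u} {v} same-edge opposite with Finₚ.<-cmp u (mate u) | Finₚ.<-cmp v (mate v)
  ... | tri≈ _ u≡ _ | _           = ⊥-elim (mate-irreflexive u u≡)
  ... | _           | tri≈ _ v≡ _ = ⊥-elim (mate-irreflexive v v≡)
  ... | tri< _ _ _  | tri< _ _ _  = ⊥-elim (opposite refl)
  ... | tri> _ _ _  | tri> _ _ _  = ⊥-elim (opposite refl)
  ... | tri< _ _ _  | tri> _ _ _  = sym (cong (proj₂ ∘ proj₁) same-edge)
  ... | tri> _ _ _  | tri< _ _ _  = sym (cong (proj₁ ∘ proj₁) same-edge)

  mate⇒opposite-ends : ∀ u → medge G M pm u ≡ medge G M pm (mate u) × msign G M pm u ≢ msign G M pm (mate u)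
  mate⇒opposite-ends u with Finₚ.<-cmp u (mate u) | Finₚ.<-cmp (mate u) (mate (mate u))
  ... | tri≈ _ u≡ _ | _           = ⊥-elim (mate-irreflexive u u≡)
  ... | _           | tri≈ _ v≡ _ = ⊥-elim (mate-irreflexive (mate u) v≡)
  ... | tri< u< _ _ | tri< v< _ _ = ⊥-elim (Finₚ.<-asym u< (subst (mate u Fin.<_) (mate-involutive u) v<))
  ... | tri> _ _ u> | tri> _ _ v> = ⊥-elim (Finₚ.<-asym u> (subst (Fin._< mate u) (mate-involutive u) v>))
  ... | tri< _ _ _  | tri> _ _ _  = MEdge-≡ (cong (_, mate u) (sym (mate-involutive u))) , λ ()
  ... | tri> _ _ _  | tri< _ _ _  = MEdge-≡ (cong (mate u ,_) (sym (mate-involutive u))) , λ ()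

  opposite-ends⇔mate : ∀ {u v} →
    (medge G M pm u ≡ medge G M pm v × msign G M pm u ≢ msign G M pm v) ⇔ v ≡ mate u
  opposite-ends⇔mate = mk⇔ (uncurry opposite-ends⇒mate) λ { refl → mate⇒opposite-ends _ }

  start end : Dart (ldg G M pm) → Fin n
  start (((a , b) , _) , false) = a
  start (((a , b) , _) , true)  = b
  end   (((a , b) , _) , false) = b
  end   (((a , b) , _) , true)  = a

  dart-adjacent : ∀ d → Adj G (start d) (end d) ≡ true
  dart-adjacent (((a , b) , _ , adj , _) , false) = adj
  dart-adjacent (((a , b) , _ , adj , _) , true)  = trans (symm G b a) adj

  dart-unmatched : ∀ d → M (start d) (end d) ≡ false
  dart-unmatched (((a , b) , _ , _ , m) , false) = m
  dart-unmatched (((a , b) , _ , _ , m) , true)  = trans (msymm pm b a) m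

  dart-from : ∀ {x u} → Adj G x u ≡ true → M x u ≡ false →
              Σ (Dart (ldg G M pm)) λ d → start d ≡ x × end d ≡ u
  dart-from {x} {u} adj unmatched with Finₚ.<-cmp x u
  ... | tri< x<u _ _ = (((x , u) , x<u , adj , unmatched) , false) , refl , refl
  ... | tri≈ _ refl _ with () ← trans (sym adj) (irrefl G x)
  ... | tri> _ _ u<x =
    (((u , x) , u<x , trans (symm G u x) adj , trans (msymm pm u x) unmatched) , true) , refl , refl

  step⇔mate : ∀ d d′ → Step (ldg G M pm) d d′ ⇔ start d′ ≡ mate (end d)
  step⇔mate (_ , false) (_ , false) = opposite-ends⇔mate
  step⇔mate (_ , false) (_ , true)  = opposite-ends⇔mate
  step⇔mate (_ , true)  (_ , false) = opposite-ends⇔mate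
  step⇔mate (_ , true)  (_ , true)  = opposite-ends⇔mate

  module _ {S : Set} (next : S → S) (dart : S → Dart (ldg G M pm))
           (steps : ∀ s → Step (ldg G M pm) (dart s) (dart (next s))) where

    orbit-linked : ∀ k s {e} → Step (ldg G M pm) (dart (iterate next s k)) e →
      Linked (Step (ldg G M pm)) (dart s ∷ List.map dart (List.iterate next (next s) k) ++ [ e ])
    orbit-linked zero    s step = step ∷ [-]
    orbit-linked (suc k) s step = steps s ∷ orbit-linked k (next s) step

    closedWalk-of-return : ∀ s k → start (dart (iterate next s (suc k))) ≡ start (dart s) →
                           LDClosedWalk (ldg G M pm)
    closedWalk-of-return s k returns = record
      { first = dart s
      ; rest  = List.map dart (List.iterate next (next s) k)
      ; steps = orbit-linked k s (Equivalence.from (step⇔mate (dart last) (dart s)) returns′)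
      }
      where
      last : S
      last = iterate next s k
      returns′ : start (dart s) ≡ mate (end (dart last))
      returns′ = begin
        start (dart s)                         ≡⟨ returns ⟨
        start (dart (iterate next s (suc k)))  ≡⟨ cong (start ∘ dart) (iterate-suc next s k) ⟨
        start (dart (next last))
          ≡⟨ Equivalence.to (step⇔mate (dart last) (dart (next last))) (steps last) ⟩
        mate (end (dart last))                 ∎
        where open ≡-Reasoning

    -- start ∘ dart takes at most n values, so the orbit of s₀ returns to an earlier start.
    closedWalk-of-successor : S → LDClosedWalk (ldg G M pm)
    closedWalk-of-successor s₀
      with i , j , i<j , same-start ←
             Finₚ.pigeonhole (ℕₚ.n<1+n n) (λ k → start (dart (iterate next s₀ (toℕ k))))
      with k , i+1+k≡j ← ℕₚ.m≤n⇒∃[o]m+o≡n i<j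
      = closedWalk-of-return (iterate next s₀ (toℕ i)) k
          (trans (cong (start ∘ dart) i+1+k≡j′) (sym same-start))
      where
      i+1+k≡j′ : iterate next (iterate next s₀ (toℕ i)) (suc k) ≡ iterate next s₀ (toℕ j)
      i+1+k≡j′ = trans (sym (iterate-+ next s₀ (toℕ i) (suc k)))
                        (cong (iterate next s₀) (trans (ℕₚ.+-suc (toℕ i) k) i+1+k≡j))

  -- Acyclic ⇒ M is the only fractional perfect matching

  module _ {w : Fin n → Fin n → ℚ} (fpm : IsFPM G w) where
    open IsFPM fpm

    saturated⇒indicator : (∀ x → w x (mate x) ≡ 1ℚ) → ∀ u v → w u v ≡ indicator M u v
    saturated⇒indicator saturated u v with v Finₚ.≟ mate u
    ... | yes refl  = trans (saturated u) (sym (indicator-onMate u))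
    ... | no v≢mate = trans (≤-antisym w≤0 (lower u v)) (sym (indicator-offMate v≢mate))
      where
      w≤0 : w u v ≤ 0ℚ
      w≤0 = p+q≤p⇒q≤0 1ℚ (subst₂ (λ a b → a + w u v ≤ b) (saturated u) (sumOne u)
              (∑-≥-pair (w u) (lower u) (v≢mate ∘ sym)))

    unsaturated⇒escape : ∀ {x} → w x (mate x) < 1ℚ → ∃ λ u → u ≢ mate x × 0ℚ < w x u
    unsaturated⇒escape {x} unsaturated =
      escape (Finₚ.¬∀⟶∃¬ n _ (λ u → (u Finₚ.≟ mate x) ⊎-dec (w x u ≤? 0ℚ)) no-escape)
      where
      escape : (∃ λ u → ¬ (u ≡ mate x ⊎ w x u ≤ 0ℚ)) → ∃ λ u → u ≢ mate x × 0ℚ < w x u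
      escape (u , ¬[u≡mate⊎w≤0]) = u , ¬[u≡mate⊎w≤0] ∘ inj₁ , ≰⇒> (¬[u≡mate⊎w≤0] ∘ inj₂)
      no-escape : ¬ (∀ u → u ≡ mate x ⊎ w x u ≤ 0ℚ)
      no-escape trapped = <-irrefl (sumOne x) (≤-<-trans
        (∑-≤-support (w x) (mate x) λ u u≢mate → [ ⊥-elim ∘ u≢mate , id ]′ (trapped u))
        unsaturated)

    escape⇒unsaturated : ∀ {x u} → u ≢ mate x → 0ℚ < w x u → w u (mate u) < 1ℚ
    escape⇒unsaturated {x} {u} u≢mate w>0 =
      <-≤-trans (p<p+q (w u (mate u)) (subst (0ℚ <_) (wsymm x u) w>0))
        (subst (w u (mate u) + w u x ≤_) (sumOne u) (∑-≥-pair (w u) (lower u) mate≢x))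
      where
      mate≢x : mate u ≢ x
      mate≢x mate≡x = u≢mate (trans (sym (mate-involutive u)) (cong mate mate≡x))

    positive⇒adjacent : ∀ {x u} → 0ℚ < w x u → Adj G x u ≡ true
    positive⇒adjacent {x} {u} w>0 with Adj G x u in eq
    ... | true  = refl
    ... | false = ⊥-elim (<⇒≢ w>0 (sym (offEdge x u eq)))

    Unsaturated : Set
    Unsaturated = Σ (Fin n) λ x → w x (mate x) < 1ℚ

    acyclic⇒saturated : Acyclic (ldg G M pm) → ∀ x → w x (mate x) ≡ 1ℚ
    acyclic⇒saturated acyclic x = ≤-antisym (upper x (mate x)) (≮⇒≥ λ unsaturated →
      acyclic (closedWalk-of-successor next dart step (x , unsaturated)))
      where
      escape : (s : Unsaturated) → ∃ λ u → u ≢ mate (proj₁ s) × 0ℚ < w (proj₁ s) u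
      escape (_ , unsaturated) = unsaturated⇒escape unsaturated

      next : Unsaturated → Unsaturated
      next s = let (u , u≢mate , w>0) = escape s in
        mate u , subst (λ v → w (mate u) v < 1ℚ) (sym (mate-involutive u))
                   (subst (_< 1ℚ) (wsymm u (mate u)) (escape⇒unsaturated u≢mate w>0))

      dart-with-ends : (s : Unsaturated) →
        Σ (Dart (ldg G M pm)) λ d → start d ≡ proj₁ s × end d ≡ proj₁ (escape s)
      dart-with-ends s = let (u , u≢mate , w>0) = escape s in
        dart-from (positive⇒adjacent w>0) (M-unmatched u≢mate)

      dart : Unsaturated → Dart (ldg G M pm)
      dart = proj₁ ∘ dart-with-ends

      step : ∀ s → Step (ldg G M pm) (dart s) (dart (next s))
      step s = Equivalence.from (step⇔mate (dart s) (dart (next s)))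
        (trans (proj₁ (proj₂ (dart-with-ends (next s))))
               (cong mate (sym (proj₂ (proj₂ (dart-with-ends s))))))

  acyclic⇒onlyFPM : Acyclic (ldg G M pm) → OnlyFPM G M
  acyclic⇒onlyFPM acyclic =
    indicator-isFPM , λ w fpm → saturated⇒indicator fpm (acyclic⇒saturated fpm acyclic)

  -- A closed walk ⇒ a second fractional perfect matching

  -- A direction in which the fractional perfect matching polytope can be entered from its
  -- vertex M by a unit step.
  record IsFeasibleDirection (D : Fin n → Fin n → ℚ) : Set where
    field
      symmetric  : ∀ u v → D u v ≡ D v u
      offEdge    : ∀ u v → Adj G u v ≡ false → D u v ≡ 0ℚ
      onMatched  : ∀ u v → M u v ≡ true → - 1ℚ ≤ D u v × D u v ≤ 0ℚ
      offMatched : ∀ u v → M u v ≡ false → 0ℚ ≤ D u v × D u v ≤ 1ℚ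
      balanced   : ∀ v → ∑ (D v) ≡ 0ℚ

  indicator+feasible-isFPM : ∀ {D} → IsFeasibleDirection D → IsFPM G (λ u v → indicator M u v + D u v)
  indicator+feasible-isFPM {D} feasible = record
    { wsymm   = λ u v → cong₂ _+_ (IsFPM.wsymm indicator-isFPM u v) (symmetric u v)
    ; offEdge = λ u v ¬adj → cong₂ _+_ (IsFPM.offEdge indicator-isFPM u v ¬adj) (offEdge u v ¬adj)
    ; lower   = λ u v → proj₁ (bounds u v)
    ; upper   = λ u v → proj₂ (bounds u v)
    ; sumOne  = λ u → begin
        ∑ (λ v → indicator M u v + D u v)  ≡⟨ ∑-distrib-+ (indicator M u) (D u) ⟩
        ∑ (indicator M u) + ∑ (D u)        ≡⟨ cong₂ _+_ (IsFPM.sumOne indicator-isFPM u) (balanced u) ⟩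
        1ℚ + 0ℚ                            ≡⟨⟩
        1ℚ                                 ∎
    }
    where
    open IsFeasibleDirection feasible
    open ≡-Reasoning
    bounds : ∀ u v → 0ℚ ≤ indicator M u v + D u v × indicator M u v + D u v ≤ 1ℚ
    bounds u v with M u v in eq
    ... | true  = let (-1≤D , D≤0) = onMatched u v eq in +-monoʳ-≤ 1ℚ -1≤D , +-monoʳ-≤ 1ℚ D≤0
    ... | false = let (0≤D , D≤1) = offMatched u v eq in
      subst (0ℚ ≤_) (sym (+-identityˡ (D u v))) 0≤D , subst (_≤ 1ℚ) (sym (+-identityˡ (D u v))) D≤1

  degree-telescopes : ∀ x d ds e → Linked (Step (ldg G M pm)) (d ∷ ds ++ [ e ]) →
    degree start end x (d ∷ ds) + δ x (start e) ≡ degree end (mate ∘ end) x (d ∷ ds) + δ x (start d)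
  degree-telescopes x d [] e (step ∷ [-]) = begin
    (a + b + 0ℚ) + δ x (start e)  ≡⟨ cong (λ v → (a + b + 0ℚ) + δ x v)
                                           (Equivalence.to (step⇔mate d e) step) ⟩
    (a + b + 0ℚ) + c              ≡⟨ solve 3 (λ a b c → (a :+ b :+ con 0ℚ) :+ c := (b :+ c :+ con 0ℚ) :+ a)
                                           refl a b c ⟩
    (b + c + 0ℚ) + a              ∎
    where
    open ≡-Reasoning
    a b c : ℚ
    a = δ x (start d)
    b = δ x (end d)
    c = δ x (mate (end d))
  degree-telescopes x d (d′ ∷ ds) e (step ∷ steps) = begin
    (a + b + F) + δ x (start e)       ≡⟨ +-assoc (a + b) F (δ x (start e)) ⟩
    (a + b) + (F + δ x (start e))     ≡⟨ cong ((a + b) +_) (degree-telescopes x d′ ds e steps) ⟩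
    (a + b) + (B + δ x (start d′))    ≡⟨ cong (λ v → (a + b) + (B + δ x v))
                                               (Equivalence.to (step⇔mate d d′) step) ⟩
    (a + b) + (B + c)                 ≡⟨ solve 4 (λ a b c B → (a :+ b) :+ (B :+ c) := ((b :+ c) :+ B) :+ a)
                                               refl a b c B ⟩
    (b + c + B) + a                   ∎
    where
    open ≡-Reasoning
    a b c F B : ℚ
    a = δ x (start d)
    b = δ x (end d)
    c = δ x (mate (end d))
    F = degree start end x (d′ ∷ ds)
    B = degree end (mate ∘ end) x (d′ ∷ ds)

  module _ (walk : LDClosedWalk (ldg G M pm)) where
    open LDClosedWalk walk

    darts : List (Dart (ldg G M pm))
    darts = first ∷ rest

    -- The unmatched edges of the walk, and the matching edges it crosses.
    forward backward : Fin n → Fin n → ℚ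
    forward  = edgeSum start end darts
    backward = edgeSum end (mate ∘ end) darts

    ∑-forward≡∑-backward : ∀ x → ∑ (forward x) ≡ ∑ (backward x)
    ∑-forward≡∑-backward x = begin
      ∑ (forward x)                    ≡⟨ ∑-edgeSum start end darts x ⟩
      degree start end x darts         ≡⟨ ∙-cancelʳ (δ x (start first)) _ _
                                            (degree-telescopes x first rest first steps) ⟩
      degree end (mate ∘ end) x darts  ≡⟨ ∑-edgeSum end (mate ∘ end) darts x ⟨
      ∑ (backward x)                   ∎
      where open ≡-Reasoning

    forward-onMatched : ∀ {u v} → M u v ≡ true → forward u v ≡ 0ℚ
    forward-onMatched m = edgeSum-outside start end M (msymm pm) dart-unmatched m darts

    backward-offMatched : ∀ {u v} → M u v ≡ false → backward u v ≡ 0ℚ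
    backward-offMatched m = edgeSum-outside end (mate ∘ end) M (msymm pm) (matched pm ∘ end) m darts

    forward-offEdge : ∀ {u v} → Adj G u v ≡ false → forward u v ≡ 0ℚ
    forward-offEdge ¬adj = edgeSum-outside start end (Adj G) (symm G) dart-adjacent ¬adj darts

    backward-offEdge : ∀ {u v} → Adj G u v ≡ false → backward u v ≡ 0ℚ
    backward-offEdge ¬adj = edgeSum-outside end (mate ∘ end) (Adj G) (symm G) (mate-adjacent ∘ end) ¬adj darts

    K : ℚ
    K = capacity darts

    instance
      K-positive : Positive K
      K-positive = positive (<-≤-trans (positive⁻¹ (1ℚ + 1ℚ)) (p≤p+q (1ℚ + 1ℚ) (0≤capacity rest)))

      K-nonZero : NonZero K
      K-nonZero = pos⇒nonZero K

    ε : ℚ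
    ε = 1/ K

    ε>0 : 0ℚ < ε
    ε>0 = positive⁻¹ ε {{1/pos⇒pos K}}

    direction : Fin n → Fin n → ℚ
    direction u v = ε * (forward u v - backward u v)

    direction-onMatched : ∀ {u v} → M u v ≡ true → direction u v ≡ - (ε * backward u v)
    direction-onMatched {u} {v} m = begin
      ε * (forward u v - backward u v)  ≡⟨ cong (λ f → ε * (f - backward u v)) (forward-onMatched m) ⟩
      ε * (0ℚ - backward u v)           ≡⟨ cong (ε *_) (+-identityˡ (- backward u v)) ⟩
      ε * - backward u v                ≡⟨ neg-distribʳ-* ε (backward u v) ⟨
      - (ε * backward u v)              ∎
      where open ≡-Reasoning

    direction-offMatched : ∀ {u v} → M u v ≡ false → direction u v ≡ ε * forward u v
    direction-offMatched {u} {v} m = begin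
      ε * (forward u v - backward u v)  ≡⟨ cong (λ b → ε * (forward u v - b)) (backward-offMatched m) ⟩
      ε * (forward u v - 0ℚ)            ≡⟨ cong (ε *_) (+-identityʳ (forward u v)) ⟩
      ε * forward u v                   ∎
      where open ≡-Reasoning

    direction-isFeasible : IsFeasibleDirection direction
    direction-isFeasible = record
      { symmetric  = λ u v → cong₂ (λ f b → ε * (f - b))
                       (edgeSum-sym start end darts u v) (edgeSum-sym end (mate ∘ end) darts u v)
      ; offEdge    = λ u v ¬adj →
          trans (cong₂ (λ f b → ε * (f - b)) (forward-offEdge ¬adj) (backward-offEdge ¬adj)) (*-zeroʳ ε)
      ; onMatched  = λ u v m →
          let (0≤εb , εb≤1) = scaled (0≤edgeSum≤capacity end (mate ∘ end) darts u v) in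
          subst (λ y → - 1ℚ ≤ y × y ≤ 0ℚ) (sym (direction-onMatched m))
            (neg-antimono-≤ εb≤1 , neg-antimono-≤ 0≤εb)
      ; offMatched = λ u v m →
          subst (λ y → 0ℚ ≤ y × y ≤ 1ℚ) (sym (direction-offMatched m))
            (scaled (0≤edgeSum≤capacity start end darts u v))
      ; balanced   = balanced
      }
      where
      scaled : ∀ {x} → 0ℚ ≤ x × x ≤ K → 0ℚ ≤ ε * x × ε * x ≤ 1ℚ
      scaled (0≤x , x≤K) = 0≤εx≤1 (<⇒≤ ε>0) (*-inverseˡ K) 0≤x x≤K
      balanced : ∀ x → ∑ (direction x) ≡ 0ℚ
      balanced x = begin
        ∑ (λ v → ε * (forward x v - backward x v))  ≡⟨ *-distribˡ-∑ ε (λ v → forward x v - backward x v) ⟨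
        ε * ∑ (λ v → forward x v - backward x v)    ≡⟨ cong (ε *_) (∑-distrib-- (forward x) (backward x)) ⟩
        ε * (∑ (forward x) - ∑ (backward x))        ≡⟨ cong (λ y → ε * (y - ∑ (backward x)))
                                                             (∑-forward≡∑-backward x) ⟩
        ε * (∑ (backward x) - ∑ (backward x))       ≡⟨ cong (ε *_) (+-inverseʳ (∑ (backward x))) ⟩
        ε * 0ℚ                                      ≡⟨ *-zeroʳ ε ⟩
        0ℚ                                          ∎
        where open ≡-Reasoning

    direction-positive : 0ℚ < direction (start first) (end first)
    direction-positive = subst (0ℚ <_) (sym (direction-offMatched (dart-unmatched first)))
      (subst (_< ε * forward (start first) (end first)) (*-zeroʳ ε)
        (*-monoʳ-<-pos ε {{positive ε>0}} forward>0))
      where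
      forward>0 : 0ℚ < forward (start first) (end first)
      forward>0 = <-≤-trans (positive⁻¹ 1ℚ) (≤-trans (1≤edge-self (start first) (end first))
        (p≤p+q _ (proj₁ (0≤edgeSum≤capacity start end rest (start first) (end first)))))

  onlyFPM⇒acyclic : OnlyFPM G M → Acyclic (ldg G M pm)
  onlyFPM⇒acyclic (_ , unique) walk = <⇒≢ (direction-positive walk) (sym (identityʳ-unique _ _
    (unique _ (indicator+feasible-isFPM (direction-isFeasible walk)) u v)))
    where
    open LDClosedWalk walk
    u v : Fin n
    u = start first
    v = end first

proposition4p9 : ∀ {n : ℕ} (G : Graph n) (M : Fin n → Fin n → Bool)
    (pm : IsPerfectMatching G M) →
    OnlyFPM G M ⇔ Acyclic (ldg G M pm)
proposition4p9 G M pm = mk⇔ (onlyFPM⇒acyclic G M pm) (acyclic⇒onlyFPM G M pm)
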